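{- Disjoint sum is an ideally effective constructor, for the following representations: an element $\langle i,x\rangle$ of $X_1\sqcup X_2$ is represented by the pair consisting of $i$ and the representation of $x$ in $X_i$, and an ideal of $X_1\sqcup X_2$ of the form $\{i\}\times J$ with $J\in\mathrm{Idl}(X_i)$ is represented by the pair consisting of $i$ and the representation of $J$ in $X_i$.
   Context: A quasi-ordering (QO) $(X,\le)$ is a set with a reflexive transitive relation; it is a well-quasi-ordering (WQO) if every infinite sequence $(x_k)_k$ has $i<j$ with $x_i\le x_j$. For $S\subseteq X$, $\uparrow S=\{x\mid \exists y\in S: y\le x\}$ and $\downarrow S=\{x\mid\exists y\in S: x\le y\}$; $S$ is upwards-closed if $S=\uparrow S$ and downwards-closed if $S=\downarrow S$. An ideal is a non-empty, downwards-closed, directed subset; $\mathrm{Idl}(X)$ is the set of ideals. In a WQO the filters are the sets $\uparrow x$, $x\in X$; $\mathrm{Fil}(X)$ is the set of filters. In a WQO every upwards-closed set is a finite union of filters and every downwards-closed set is a finite union of ideals; upwards-closed (resp. downwards-closed) sets are represented as finite lists of filters (resp. ideals), a filter $\uparrow x$ being represented by $x$. A WQO equipped with data structures (recursive sets of representations) for $X$ and $\mathrm{Idl}(X)$ is ideally effective if: (OD) $\le$ is decidable on $X$; (ID) inclusion is decidable on $\mathrm{Idl}(X)$; (PI) $x\mapsto\downarrow x$ is computable; (CF) the complement $X\setminus\uparrow x$ of a filter is computable as a finite union of ideals; (IF) the intersection of two filters is computable as a finite union of filters; (CI) the complement of an ideal is computable as a finite union of filters; (II) the intersection of two ideals is computable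 as a finite union of ideals. A presentation of an ideally effective WQO consists of the data structures for $X$ and $\mathrm{Idl}(X)$, algorithms for these seven operations, a decomposition of $X$ as a finite union of ideals, and a decomposition of $X$ as a finite union of filters. An order-theoretic constructor $C$ mapping QOs $(X_1,\le_1),\dots,(X_n,\le_n)$ to a QO $C[(X_1,\le_1),\dots,(X_n,\le_n)]$, and mapping WQOs to WQOs, is ideally effective if (1) $C[(X_1,\le_1),\dots,(X_n,\le_n)]$ is ideally effective whenever each $(X_i,\le_i)$ is, and (2) a presentation of $C[(X_1,\le_1),\dots,(X_n,\le_n)]$ is uniformly computable from presentations of the $(X_i,\le_i)$. The disjoint sum of QOs $(X_1,\le_1),(X_2,\le_2)$ is $X_1\sqcup X_2=\{1\}\times X_1\cup\{2\}\times X_2$ ordered by $\langle i,x\rangle\le_\sqcup\langle j,y\rangle$ iff $i=j$ and $x\le_i y$. Its ideals are exactly the sets $\{i\}\times J$ with $i\in\{1,2\}$ and $J\in\mathrm{Idl}(X_i)$. -}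

module Defs where

open import Level using (0ℓ)
open import Data.Nat using (ℕ; _<_)
open import Data.Product using (Σ; ∃; ∃-syntax; _×_; _,_)
open import Data.Sum using (_⊎_; inj₁; inj₂)
open import Data.Empty using (⊥)
open import Data.List using (List)
open import Data.List.Relation.Unary.Any using (Any)
open import Relation.Nullary using (Dec)
open import Relation.Unary using (Pred; _⊆_; _≐_; _∩_; ∁; U)

-- Quasi-orderings (carrier type = data structure of element representations)

record QO : Set₁ where
  field
    Carrier : Set
    _≤_     : Carrier → Carrier → Set
    ≤-refl  : ∀ {x} → x ≤ x
    ≤-trans : ∀ {x y z} → x ≤ y → y ≤ z → x ≤ z

module _ (Q : QO) where
  open QO Q

  IsWQO : Set
  IsWQO = (f : ℕ → Carrier) → ∃[ i ] ∃[ j ] (i < j × f i ≤ f j)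

  ↑ : Carrier → Pred Carrier 0ℓ
  ↑ x = λ y → x ≤ y

  ↓ : Carrier → Pred Carrier 0ℓ
  ↓ x = λ y → y ≤ x

  DownwardsClosed : Pred Carrier 0ℓ → Set
  DownwardsClosed S = ∀ {x y} → y ≤ x → S x → S y

  Directed : Pred Carrier 0ℓ → Set
  Directed S = ∀ {x y} → S x → S y → ∃[ z ] (S z × x ≤ z × y ≤ z)

  IsIdeal : Pred Carrier 0ℓ → Set
  IsIdeal S = (∃[ x ] S x) × DownwardsClosed S × Directed S

  -- finite union of filters ↑ y, y ∈ ys (filter ↑ y represented by y)
  ⋃Fil : List Carrier → Pred Carrier 0ℓ
  ⋃Fil ys = λ x → Any (λ y → y ≤ x) ys

  -- Presentation of an ideally effective WQO, relative to a data structure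
  -- IRep for ideals with denotation ⟦_⟧.  Elements are represented by
  -- values of Carrier; "computable" = given by an Agda function.
  record Presentation (IRep : Set) (⟦_⟧ : IRep → Pred Carrier 0ℓ) : Set₁ where
    ⋃Idl : List IRep → Pred Carrier 0ℓ
    ⋃Idl rs = λ x → Any (λ r → ⟦ r ⟧ x) rs
    field
      rep-sound    : ∀ r → IsIdeal ⟦ r ⟧
      rep-complete : ∀ (J : Pred Carrier 0ℓ) → IsIdeal J → ∃[ r ] (⟦ r ⟧ ≐ J)
      OD : ∀ x y → Dec (x ≤ y)
      ID : ∀ r s → Dec (⟦ r ⟧ ⊆ ⟦ s ⟧)
      PI : ∀ x → Σ IRep (λ r → ⟦ r ⟧ ≐ ↓ x)
      CF : ∀ x → Σ (List IRep) (λ rs → ⋃Idl rs ≐ ∁ (↑ x))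
      IF : ∀ x y → Σ (List Carrier) (λ zs → ⋃Fil zs ≐ (↑ x ∩ ↑ y))
      CI : ∀ r → Σ (List Carrier) (λ zs → ⋃Fil zs ≐ ∁ ⟦ r ⟧)
      II : ∀ r s → Σ (List IRep) (λ ts → ⋃Idl ts ≐ (⟦ r ⟧ ∩ ⟦ s ⟧))
      X-ideals  : Σ (List IRep) (λ rs → ⋃Idl rs ≐ U)
      X-filters : Σ (List Carrier) (λ zs → ⋃Fil zs ≐ U)

-- Disjoint sum: ⟨1,x⟩ is inj₁ x and ⟨2,y⟩ is inj₂ y

module _ (Q₁ Q₂ : QO) where
  private
    module A = QO Q₁
    module B = QO Q₂

  _≤⊔_ : A.Carrier ⊎ B.Carrier → A.Carrier ⊎ B.Carrier → Set
  inj₁ x ≤⊔ inj₁ y = x A.≤ y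
  inj₁ x ≤⊔ inj₂ y = ⊥
  inj₂ x ≤⊔ inj₁ y = ⊥
  inj₂ x ≤⊔ inj₂ y = x B.≤ y

  private
    refl⊔ : ∀ {x} → x ≤⊔ x
    refl⊔ {inj₁ x} = A.≤-refl
    refl⊔ {inj₂ x} = B.≤-refl

    trans⊔ : ∀ {x y z} → x ≤⊔ y → y ≤⊔ z → x ≤⊔ z
    trans⊔ {inj₁ x} {inj₁ y} {inj₁ z} p q = A.≤-trans p q
    trans⊔ {inj₂ x} {inj₂ y} {inj₂ z} p q = B.≤-trans p q

  DisjSum : QO
  DisjSum = record { Carrier = A.Carrier ⊎ B.Carrier ; _≤_ = _≤⊔_
                   ; ≤-refl = λ {x} → refl⊔ {x} ; ≤-trans = λ {x} {y} {z} → trans⊔ {x} {y} {z} }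

  sumSem : {R₁ R₂ : Set} → (R₁ → Pred A.Carrier 0ℓ) → (R₂ → Pred B.Carrier 0ℓ)
         → R₁ ⊎ R₂ → Pred (A.Carrier ⊎ B.Carrier) 0ℓ
  sumSem ⟦_⟧₁ ⟦_⟧₂ (inj₁ r) (inj₁ x) = ⟦ r ⟧₁ x
  sumSem ⟦_⟧₁ ⟦_⟧₂ (inj₁ r) (inj₂ y) = ⊥
  sumSem ⟦_⟧₁ ⟦_⟧₂ (inj₂ r) (inj₁ x) = ⊥
  sumSem ⟦_⟧₁ ⟦_⟧₂ (inj₂ r) (inj₂ y) = ⟦ r ⟧₂ y

-- Everything about X₁ ⊔ X₂ reduces to its two summands, because every
-- predicate on A ⊎ B is determined by its restrictions along inj₁ and inj₂.
module Submission where

open import Defs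
open import Level using (0ℓ)
open import Data.Product using (_×_)
open import Data.Sum using (_⊎_)
open import Relation.Unary using (Pred)

open import Data.Nat using (ℕ; zero; suc; _+_; _<_; _≤_; _<′_; ≤′-reflexive; ≤′-step)
open import Data.Nat.Properties using (≤-refl; m≤m+n; +-monoʳ-<; <-trans; <⇒<′)
open import Data.Product using (Σ; ∃-syntax; _,_; proj₁; proj₂)
open import Data.Sum using (inj₁; inj₂; [_,_])
import Data.Sum as Sum
open import Data.Empty using (⊥; ⊥-elim)
open import Data.Unit using (tt)
open import Data.List using (List; []; map; _++_)
open import Data.List.Relation.Unary.Any using (Any; satisfied)
open import Data.List.Relation.Unary.Any.Properties using (map⁺; map⁻; ++⁺ˡ; ++⁺ʳ; ++⁻; ¬Any[])
open import Function using (_∘_; id)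
open import Relation.Nullary using (Dec; no; ¬_)
open import Relation.Nullary.Decidable using (map′)
open import Relation.Binary.PropositionalEquality using (_≡_; refl)
open import Relation.Unary using (_≐_; _⊆_; _∪_; _∩_; ∁; U)
open import Relation.Unary.Properties using (≐-refl; ≐-trans)

-- The union of the denotations of a list of representations; both ⋃Fil and
-- the ⋃Idl of a presentation are instances of it.
Union : {R X : Set} → (R → Pred X 0ℓ) → List R → Pred X 0ℓ
Union D rs x = Any (λ r → D r x) rs

Computed : {R X : Set} → (R → Pred X 0ℓ) → Pred X 0ℓ → Set
Computed {R} D T = Σ (List R) (λ rs → Union D rs ≐ T)

empty-≐ : {X : Set} {P Q : Pred X 0ℓ} → (∀ {x} → ¬ P x) → (∀ {x} → ¬ Q x) → P ≐ Q
empty-≐ ¬P ¬Q = (λ p → ⊥-elim (¬P p)) , (λ q → ⊥-elim (¬Q q))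

none : {R X : Set} {D : R → Pred X 0ℓ} {T : Pred X 0ℓ} → (∀ {x} → ¬ T x) → Computed D T
none ¬T = [] , empty-≐ ¬Any[] ¬T

everywhere : {R X : Set} {D : R → Pred X 0ℓ} {T : Pred X 0ℓ}
           → Computed D U → (∀ {x} → T x) → Computed D T
everywhere (rs , rs≐U) always = rs , ≐-trans rs≐U ((λ _ → always) , (λ _ → tt))

join : {R₁ R₂ : Set} → List R₁ → List R₂ → List (R₁ ⊎ R₂)
join rs ts = map inj₁ rs ++ map inj₂ ts

module SumPredicates {A B : Set} where

  ⊆-split : {P Q : Pred (A ⊎ B) 0ℓ}
          → P ∘ inj₁ ⊆ Q ∘ inj₁ → P ∘ inj₂ ⊆ Q ∘ inj₂ → P ⊆ Q
  ⊆-split left right {inj₁ x} = left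
  ⊆-split left right {inj₂ y} = right

  ≐-split : {P Q : Pred (A ⊎ B) 0ℓ}
          → P ∘ inj₁ ≐ Q ∘ inj₁ → P ∘ inj₂ ≐ Q ∘ inj₂ → P ≐ Q
  ≐-split {P = P} {Q} (l⊆ , l⊇) (r⊆ , r⊇) = ⊆-split {P = P} {Q} l⊆ r⊆ , ⊆-split {P = Q} {P} l⊇ r⊇

  Union-join : {R₁ R₂ : Set} (D : R₁ ⊎ R₂ → Pred (A ⊎ B) 0ℓ) (rs : List R₁) (ts : List R₂)
             → Union D (join rs ts) ≐ (Union (D ∘ inj₁) rs ∪ Union (D ∘ inj₂) ts)
  Union-join D rs ts =
      (λ p → Sum.map map⁻ map⁻ (++⁻ (map inj₁ rs) p))
    , [ ++⁺ˡ ∘ map⁺ , ++⁺ʳ (map inj₁ rs) ∘ map⁺ ]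

  join-≐ : {R₁ R₂ : Set} (D : R₁ ⊎ R₂ → Pred (A ⊎ B) 0ℓ)
         → (∀ {r y} → ¬ D (inj₁ r) (inj₂ y)) → (∀ {t x} → ¬ D (inj₂ t) (inj₁ x))
         → {T : Pred (A ⊎ B) 0ℓ} {rs : List R₁} {ts : List R₂}
         → Union (λ r → D (inj₁ r) ∘ inj₁) rs ≐ T ∘ inj₁
         → Union (λ t → D (inj₂ t) ∘ inj₂) ts ≐ T ∘ inj₂
         → Union D (join rs ts) ≐ T
  join-≐ D onLeft onRight {rs = rs} {ts} rs≐T₁ ts≐T₂ =
    ≐-split (≐-trans leftPart rs≐T₁) (≐-trans rightPart ts≐T₂)
    where
      split : Union D (join rs ts) ≐ (Union (D ∘ inj₁) rs ∪ Union (D ∘ inj₂) ts)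
      split = Union-join D rs ts
      leftPart : Union D (join rs ts) ∘ inj₁ ≐ Union (λ r → D (inj₁ r) ∘ inj₁) rs
      leftPart = (λ p → [ id , (λ q → ⊥-elim (onRight (proj₂ (satisfied q)))) ] (proj₁ split p))
               , (λ p → proj₂ split (inj₁ p))
      rightPart : Union D (join rs ts) ∘ inj₂ ≐ Union (λ t → D (inj₂ t) ∘ inj₂) ts
      rightPart = (λ p → [ (λ q → ⊥-elim (onLeft (proj₂ (satisfied q)))) , id ] (proj₁ split p))
                , (λ p → proj₂ split (inj₂ p))

  OnLeft OnRight : Pred (A ⊎ B) 0ℓ → Set
  OnLeft P = ∀ {y} → ¬ P (inj₂ y)
  OnRight P = ∀ {x} → ¬ P (inj₁ x)

  IsLeft : A ⊎ B → Set
  IsLeft z = Σ A (λ a → z ≡ inj₁ a)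

open SumPredicates

module SumOrder (Q₁ Q₂ : QO) where
  private
    module Q₁ = QO Q₁
    module Q₂ = QO Q₂
    S : QO
    S = DisjSum Q₁ Q₂
    _≤ₛ_ : QO.Carrier S → QO.Carrier S → Set
    _≤ₛ_ = QO._≤_ S

  no-common-upper : ∀ {a b} z → inj₁ a ≤ₛ z → inj₂ b ≤ₛ z → ⊥
  no-common-upper (inj₁ _) _ ()
  no-common-upper (inj₂ _) () _

  ideal-from-left : {P : Pred (Q₁.Carrier ⊎ Q₂.Carrier) 0ℓ}
                  → OnLeft P → IsIdeal Q₁ (P ∘ inj₁) → IsIdeal S P
  ideal-from-left {P} notRight ((a , Pa) , dc , dir) = (inj₁ a , Pa) , dcS , dirS
    where
      dcS : DownwardsClosed S P
      dcS {inj₁ _} {inj₁ _} y≤x Px = dc y≤x Px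
      dcS {inj₂ _} _ Px = ⊥-elim (notRight Px)
      dirS : Directed S P
      dirS {inj₁ _} {inj₁ _} Px Py = let z , upper = dir Px Py in inj₁ z , upper
      dirS {inj₂ _} Px _ = ⊥-elim (notRight Px)
      dirS {inj₁ _} {inj₂ _} _ Py = ⊥-elim (notRight Py)

  ideal-from-right : {P : Pred (Q₁.Carrier ⊎ Q₂.Carrier) 0ℓ}
                   → OnRight P → IsIdeal Q₂ (P ∘ inj₂) → IsIdeal S P
  ideal-from-right {P} notLeft ((b , Pb) , dc , dir) = (inj₂ b , Pb) , dcS , dirS
    where
      dcS : DownwardsClosed S P
      dcS {inj₂ _} {inj₂ _} y≤x Px = dc y≤x Px
      dcS {inj₁ _} _ Px = ⊥-elim (notLeft Px)
      dirS : Directed S P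
      dirS {inj₂ _} {inj₂ _} Px Py = let z , upper = dir Px Py in inj₂ z , upper
      dirS {inj₁ _} Px _ = ⊥-elim (notLeft Px)
      dirS {inj₂ _} {inj₁ _} _ Py = ⊥-elim (notLeft Py)

  ideal-to-left : {J : Pred (Q₁.Carrier ⊎ Q₂.Carrier) 0ℓ}
                → IsIdeal S J → ∀ {a} → J (inj₁ a) → OnLeft J × IsIdeal Q₁ (J ∘ inj₁)
  ideal-to-left {J} (_ , dc , dir) {a} Ja =
    notRight , (a , Ja) , (λ {x} {y} → dc {inj₁ x} {inj₁ y}) , dir₁
    where
      notRight : OnLeft J
      notRight Jy = let z , _ , a≤z , y≤z = dir Ja Jy in no-common-upper z a≤z y≤z
      dir₁ : Directed Q₁ (J ∘ inj₁)
      dir₁ Jx Jy with dir Jx Jy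
      ... | inj₁ z , upper = z , upper
      ... | inj₂ _ , _ , () , _

  ideal-to-right : {J : Pred (Q₁.Carrier ⊎ Q₂.Carrier) 0ℓ}
                 → IsIdeal S J → ∀ {b} → J (inj₂ b) → OnRight J × IsIdeal Q₂ (J ∘ inj₂)
  ideal-to-right {J} (_ , dc , dir) {b} Jb =
    notLeft , (b , Jb) , (λ {x} {y} → dc {inj₂ x} {inj₂ y}) , dir₂
    where
      notLeft : OnRight J
      notLeft Jx = let z , _ , x≤z , b≤z = dir Jx Jb in no-common-upper z x≤z b≤z
      dir₂ : Directed Q₂ (J ∘ inj₂)
      dir₂ Jx Jy with dir Jx Jy
      ... | inj₂ z , upper = z , upper
      ... | inj₁ _ , _ , () , _

module SumWQO (Q₁ Q₂ : QO) (wqo₁ : IsWQO Q₁) (wqo₂ : IsWQO Q₂)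
              (f : ℕ → QO.Carrier Q₁ ⊎ QO.Carrier Q₂) where
  private
    module Q₁ = QO Q₁
    module Q₂ = QO Q₂
    _≤ₛ_ : Q₁.Carrier ⊎ Q₂.Carrier → Q₁.Carrier ⊎ Q₂.Carrier → Set
    _≤ₛ_ = _≤⊔_ Q₁ Q₂

  Good : Set
  Good = ∃[ i ] ∃[ j ] (i < j × f i ≤ₛ f j)

  rightPart : Q₂.Carrier → Q₁.Carrier ⊎ Q₂.Carrier → Q₂.Carrier
  rightPart b₀ (inj₁ _) = b₀
  rightPart b₀ (inj₂ b) = b

  rightCompare : ∀ b₀ x y → rightPart b₀ x Q₂.≤ rightPart b₀ y → x ≤ₛ y ⊎ (IsLeft x ⊎ IsLeft y)
  rightCompare b₀ (inj₁ a) y _ = inj₂ (inj₁ (a , refl))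
  rightCompare b₀ (inj₂ b) (inj₁ a) _ = inj₂ (inj₂ (a , refl))
  rightCompare b₀ (inj₂ b) (inj₂ b′) b≤b′ = inj₁ b≤b′

  -- From position s on, either there is a good pair, or a left element occurs
  -- at some position q ≥ s (q is returned in both cases, so that it can be iterated).
  goodOrLeftFrom : ∀ s → Σ ℕ (λ q → s ≤ q × (Good ⊎ IsLeft (f q)))
  goodOrLeftFrom s with f s in fs≡
  ... | inj₁ a = s , ≤-refl , inj₂ (a , fs≡)
  ... | inj₂ b₀ with wqo₂ (λ m → rightPart b₀ (f (s + m)))
  ...   | i , j , i<j , le with rightCompare b₀ (f (s + i)) (f (s + j)) le
  ...     | inj₁ fi≤fj = s , ≤-refl , inj₁ (s + i , s + j , +-monoʳ-< s i<j , fi≤fj)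
  ...     | inj₂ (inj₁ left) = s + i , m≤m+n s i , inj₂ left
  ...     | inj₂ (inj₂ left) = s + j , m≤m+n s j , inj₂ left

  start pos : ℕ → ℕ
  start zero = 0
  start (suc n) = suc (pos n)
  pos n = proj₁ (goodOrLeftFrom (start n))

  stage : ∀ n → Good ⊎ IsLeft (f (pos n))
  stage n = proj₂ (proj₂ (goodOrLeftFrom (start n)))

  pos-step : ∀ n → pos n < pos (suc n)
  pos-step n = proj₁ (proj₂ (goodOrLeftFrom (start (suc n))))

  pos-mono : ∀ {i j} → i <′ j → pos i < pos j
  pos-mono {i} (≤′-reflexive refl) = pos-step i
  pos-mono (≤′-step i<j) = <-trans (pos-mono i<j) (pos-step _)

  leftPart : ∀ {n} → Q₁.Carrier → Good ⊎ IsLeft (f (pos n)) → Q₁.Carrier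
  leftPart a₀ (inj₁ _) = a₀
  leftPart a₀ (inj₂ (a , _)) = a

  leftPair : ∀ {x y a a′} → x ≡ inj₁ a → y ≡ inj₁ a′ → a Q₁.≤ a′ → x ≤ₛ y
  leftPair refl refl a≤a′ = a≤a′

  -- If the first search already finds a good pair we are done; otherwise its
  -- left element a₀ serves as default, and a good pair of the left components
  -- of the stages yields a good pair of f (unless a stage found one itself).
  good : Good
  good with stage 0
  ... | inj₁ found = found
  ... | inj₂ (a₀ , _) with wqo₁ (λ n → leftPart a₀ (stage n))
  ...   | i , j , i<j , le = combine (stage i) (stage j) le
    where
      combine : (sᵢ : Good ⊎ IsLeft (f (pos i))) (sⱼ : Good ⊎ IsLeft (f (pos j)))
              → leftPart a₀ sᵢ Q₁.≤ leftPart a₀ sⱼ → Good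
      combine (inj₁ found) _ _ = found
      combine (inj₂ _) (inj₁ found) _ = found
      combine (inj₂ (_ , eqᵢ)) (inj₂ (_ , eqⱼ)) aᵢ≤aⱼ =
        pos i , pos j , pos-mono (<⇒<′ i<j) , leftPair eqᵢ eqⱼ aᵢ≤aⱼ

sumWQO : (Q₁ Q₂ : QO) → IsWQO Q₁ → IsWQO Q₂ → IsWQO (DisjSum Q₁ Q₂)
sumWQO Q₁ Q₂ wqo₁ wqo₂ f = SumWQO.good Q₁ Q₂ wqo₁ wqo₂ f

module SumPresentation (Q₁ Q₂ : QO)
    (R₁ : Set) (⟦_⟧₁ : R₁ → Pred (QO.Carrier Q₁) 0ℓ)
    (R₂ : Set) (⟦_⟧₂ : R₂ → Pred (QO.Carrier Q₂) 0ℓ)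
    (P₁ : Presentation Q₁ R₁ ⟦_⟧₁) (P₂ : Presentation Q₂ R₂ ⟦_⟧₂) where
  private
    module P₁ = Presentation P₁
    module P₂ = Presentation P₂
    X : Set
    X = QO.Carrier Q₁ ⊎ QO.Carrier Q₂
    S : QO
    S = DisjSum Q₁ Q₂
  open SumOrder Q₁ Q₂

  ⟦_⟧ : R₁ ⊎ R₂ → Pred X 0ℓ
  ⟦_⟧ = sumSem Q₁ Q₂ ⟦_⟧₁ ⟦_⟧₂

  joinIdeals : {T : Pred X 0ℓ}
             → Computed ⟦_⟧₁ (T ∘ inj₁) → Computed ⟦_⟧₂ (T ∘ inj₂) → Computed ⟦_⟧ T
  joinIdeals (rs , rs≐) (ts , ts≐) = join rs ts , join-≐ ⟦_⟧ (λ ()) (λ ()) rs≐ ts≐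

  joinFilters : {T : Pred X 0ℓ}
              → Computed (↑ Q₁) (T ∘ inj₁) → Computed (↑ Q₂) (T ∘ inj₂) → Computed (↑ S) T
  joinFilters (zs , zs≐) (ws , ws≐) = join zs ws , join-≐ (↑ S) (λ ()) (λ ()) zs≐ ws≐

  -- The representations denote exactly the ideals: ideals of a summand are
  -- ideals of the sum, and every ideal of the sum lives on one summand.
  sound : ∀ r → IsIdeal S ⟦ r ⟧
  sound (inj₁ r) = ideal-from-left (λ ()) (P₁.rep-sound r)
  sound (inj₂ t) = ideal-from-right (λ ()) (P₂.rep-sound t)

  complete : ∀ J → IsIdeal S J → ∃[ r ] (⟦ r ⟧ ≐ J)
  complete J I@((inj₁ a , Ja) , _) =
    let notRight , I₁ = ideal-to-left I Ja
        r , r≐J = P₁.rep-complete (J ∘ inj₁) I₁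
    in inj₁ r , ≐-split r≐J (empty-≐ (λ ()) notRight)
  complete J I@((inj₂ b , Jb) , _) =
    let notLeft , I₂ = ideal-to-right I Jb
        t , t≐J = P₂.rep-complete (J ∘ inj₂) I₂
    in inj₂ t , ≐-split (empty-≐ (λ ()) notLeft) t≐J

  decide-≤ : ∀ x y → Dec (QO._≤_ S x y)
  decide-≤ (inj₁ a) (inj₁ a′) = P₁.OD a a′
  decide-≤ (inj₁ _) (inj₂ _) = no λ ()
  decide-≤ (inj₂ _) (inj₁ _) = no λ ()
  decide-≤ (inj₂ b) (inj₂ b′) = P₂.OD b b′

  -- Ideals on the same side compare as in the summand; ideals on different
  -- sides are incomparable because ideals are non-empty.
  left-⊆ : ∀ {r s} → ⟦ r ⟧₁ ⊆ ⟦ s ⟧₁ → ⟦ inj₁ r ⟧ ⊆ ⟦ inj₁ s ⟧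
  left-⊆ r⊆s {inj₁ _} = r⊆s
  left-⊆ r⊆s {inj₂ _} ()

  right-⊆ : ∀ {r s} → ⟦ r ⟧₂ ⊆ ⟦ s ⟧₂ → ⟦ inj₂ r ⟧ ⊆ ⟦ inj₂ s ⟧
  right-⊆ r⊆s {inj₂ _} = r⊆s
  right-⊆ r⊆s {inj₁ _} ()

  decide-⊆ : ∀ r s → Dec (⟦ r ⟧ ⊆ ⟦ s ⟧)
  decide-⊆ (inj₁ r) (inj₁ s) = map′ left-⊆ (λ r⊆s {x} → r⊆s {inj₁ x}) (P₁.ID r s)
  decide-⊆ (inj₂ r) (inj₂ s) = map′ right-⊆ (λ r⊆s {y} → r⊆s {inj₂ y}) (P₂.ID r s)
  decide-⊆ (inj₁ r) (inj₂ _) =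
    let a , a∈r = proj₁ (P₁.rep-sound r) in no λ r⊆s → r⊆s {inj₁ a} a∈r
  decide-⊆ (inj₂ r) (inj₁ _) =
    let b , b∈r = proj₁ (P₂.rep-sound r) in no λ r⊆s → r⊆s {inj₂ b} b∈r

  principal : ∀ x → Σ (R₁ ⊎ R₂) (λ r → ⟦ r ⟧ ≐ ↓ S x)
  principal (inj₁ a) = let r , r≐↓a = P₁.PI a in inj₁ r , ≐-split r≐↓a ≐-refl
  principal (inj₂ b) = let t , t≐↓b = P₂.PI b in inj₂ t , ≐-split ≐-refl t≐↓b

  -- The complement of a filter or ideal on one side contains the whole other side.
  complement-filter : ∀ x → Computed ⟦_⟧ (∁ (↑ S x))
  complement-filter (inj₁ a) = joinIdeals (P₁.CF a) (everywhere P₂.X-ideals λ ())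
  complement-filter (inj₂ b) = joinIdeals (everywhere P₁.X-ideals λ ()) (P₂.CF b)

  complement-ideal : ∀ r → Computed (↑ S) (∁ ⟦ r ⟧)
  complement-ideal (inj₁ r) = joinFilters (P₁.CI r) (everywhere P₂.X-filters λ ())
  complement-ideal (inj₂ t) = joinFilters (everywhere P₁.X-filters λ ()) (P₂.CI t)

  meet-filters : ∀ x y → Computed (↑ S) (↑ S x ∩ ↑ S y)
  meet-filters (inj₁ a) (inj₁ a′) = joinFilters (P₁.IF a a′) (none proj₁)
  meet-filters (inj₂ b) (inj₂ b′) = joinFilters (none proj₁) (P₂.IF b b′)
  meet-filters (inj₁ _) (inj₂ _) = joinFilters (none proj₂) (none proj₁)
  meet-filters (inj₂ _) (inj₁ _) = joinFilters (none proj₁) (none proj₂)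

  meet-ideals : ∀ r s → Computed ⟦_⟧ (⟦ r ⟧ ∩ ⟦ s ⟧)
  meet-ideals (inj₁ r) (inj₁ s) = joinIdeals (P₁.II r s) (none proj₁)
  meet-ideals (inj₂ r) (inj₂ s) = joinIdeals (none proj₁) (P₂.II r s)
  meet-ideals (inj₁ _) (inj₂ _) = joinIdeals (none proj₂) (none proj₁)
  meet-ideals (inj₂ _) (inj₁ _) = joinIdeals (none proj₁) (none proj₂)

  presentation : Presentation S (R₁ ⊎ R₂) ⟦_⟧
  presentation = record
    { rep-sound = sound
    ; rep-complete = complete
    ; OD = decide-≤
    ; ID = decide-⊆
    ; PI = principal
    ; CF = complement-filter
    ; IF = meet-filters
    ; CI = complement-ideal
    ; II = meet-ideals
    ; X-ideals = joinIdeals P₁.X-ideals P₂.X-ideals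
    ; X-filters = joinFilters P₁.X-filters P₂.X-filters
    }

mainTheorem1 : (Q₁ Q₂ : QO)
    → (R₁ : Set) (⟦_⟧₁ : R₁ → Pred (QO.Carrier Q₁) 0ℓ)
    → (R₂ : Set) (⟦_⟧₂ : R₂ → Pred (QO.Carrier Q₂) 0ℓ)
    → (IsWQO Q₁ × Presentation Q₁ R₁ ⟦_⟧₁)
    → (IsWQO Q₂ × Presentation Q₂ R₂ ⟦_⟧₂)
    → IsWQO (DisjSum Q₁ Q₂)
      × Presentation (DisjSum Q₁ Q₂) (R₁ ⊎ R₂) (sumSem Q₁ Q₂ ⟦_⟧₁ ⟦_⟧₂)
mainTheorem1 Q₁ Q₂ R₁ ⟦_⟧₁ R₂ ⟦_⟧₂ (wqo₁ , P₁) (wqo₂ , P₂) =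
    sumWQO Q₁ Q₂ wqo₁ wqo₂
  , SumPresentation.presentation Q₁ Q₂ R₁ ⟦_⟧₁ R₂ ⟦_⟧₂ P₁ P₂
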